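{- Let $N\geq 2$ and let $(x_n)_{n\geq 1}$ be the sequence defined by the recurrence $x_n x_{n+N}=x_{n+1}x_{n+N-1}+1$ (the recurrence obtained from the cluster exchange relation for the first period $1$ primitive quiver $P_N^{(1)}$ with $N$ nodes) with initial conditions $x_1=x_2=\cdots=x_N=1$. (a) Suppose that $N=2r-1$ is odd. For $m\in\mathbb{Z}$, $m\geq 0$, let $a_m=x_{(N-1)m+r}$. Choose $1\leq t\leq N-1$, and let $b_m=x_{(N-1)m+t+1}-x_{(N-1)m+t}$. Then the pairs $(a_m,b_m)$ for $m>0$ are the positive integer solutions of the Pell equation $a^2-(r^2-1)b^2=1$. (b) Suppose that $N=2r$ is even. Choose $t,t'$ such that $1\leq t\leq r$ and $1\leq t'\leq N-1$. For $m\in\mathbb{Z}$, $m\geq 0$, let $a_m=x_{(N-1)m+t}+x_{(N-1)m+N+1-t}$ and let $b_m=x_{(N-1)m+t'+1}-x_{(N-1)m+t'}$. Then the pairs $(a_m,b_m)$ for $m>0$ are the positive integer solutions of the Pell equation $a^2-((2r+1)^2-4)b^2=4$.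
   Context: The primitive $P_N^{(1)}$ is a period $1$ quiver: mutating at node $1$ gives the same quiver rotated by the cyclic relabelling of nodes. Attaching cluster variables $x_1,\dots,x_N$ to the nodes and successively mutating at nodes $1,2,3,\dots$ (setting $x_{N+n}$ to be the new variable replacing $x_n$), the cluster exchange relation gives $x_n x_{n+N}=x_{n+1}x_{n+N-1}+1$. This sequence also satisfies the linear recurrence $x_n+x_{n+2(N-1)}=S_{N,1}x_{n+N-1}$, and with all initial terms equal to $1$ one has $x_n=n-N+1$ for $N\leq n\leq 2N-1$, giving $S_{N,1}=N+1$. -}

module Defs where

open import Data.Nat using (ℕ; suc; _+_; _*_; _∸_; _≤_; _^_)
open import Data.Integer using (+_)
open import Data.Rational using (ℚ; _/_; 1ℚ)
import Data.Rational as Q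
open import Data.Product using (_×_)
open import Relation.Binary.PropositionalEquality using (_≡_)

ℕ→ℚ : ℕ → ℚ
ℕ→ℚ n = + n / 1

-- x : ℕ → ℚ is the sequence attached to the period-1 primitive quiver P_N^(1)
-- with all initial values 1 (indices start at 1; the value at 0 is irrelevant):
--   x_1 = ... = x_N = 1   and   x_n x_{n+N} = x_{n+1} x_{n+N-1} + 1  for n ≥ 1.
-- The values are taken in ℚ so that the recurrence determines the sequence
-- (all terms turn out to be positive integers, so division is always possible).
IsP1Sequence : ℕ → (ℕ → ℚ) → Set
IsP1Sequence N x =
  (∀ i → 1 ≤ i → i ≤ N → x i ≡ 1ℚ) ×
  (∀ n → 1 ≤ n → x n Q.* x (n + N) ≡ x (suc n) Q.* x (n + N ∸ 1) Q.+ 1ℚ)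

module Submission where

-- With c = N − 1 the sequence is piecewise arithmetic: x_{ck+1+j} = e_k + j·b_k for
-- 0 ≤ j ≤ c, where (e₀, b₀) = (1, 0), e_{k+1} = e_k + c·b_k and b_{k+1} = b_k + e_{k+1}.
-- This step preserves e² + c·b·e − c·b² = 1, and on solutions with b > 0 it can be run
-- backwards with b strictly decreasing, so the orbit of (1, 0) consists of exactly the
-- natural solutions of that equation. Completing the square turns both Pell equations
-- into it: a = s·b + e when c = 2s, and a = c·b + 2e in general.

open import Defs
open import Data.Nat using (ℕ; zero; suc; _+_; _*_; _∸_; _≤_; _<_; _^_; z≤n; s≤s; s≤s⁻¹)
open import Data.Nat.Properties
open import Data.Nat.Divisibility using (_∣_; divides; ∣-trans; m∣m*n; ∣m+n∣m⇒∣n)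
open import Data.Nat.Primality using (euclidsLemma; prime[2])
open import Data.Nat.Induction using (<-rec)
open import Data.Nat.Tactic.RingSolver using (solve-∀; solve)
import Data.Integer as ℤ
import Data.Integer.Properties as ℤ
open import Data.Rational using (ℚ; 1ℚ; toℚᵘ; 1/_)
import Data.Rational as Q
open import Data.Rational.Properties
  using (normalize-coprime; toℚᵘ-injective; toℚᵘ-homo-+; toℚᵘ-homo-*;
         pos⇒nonZero; normalize-pos; *-inverseˡ; +-0-abelianGroup)
  renaming (*-assoc to ℚ-*-assoc; *-identityˡ to ℚ-*-identityˡ)
import Data.Rational.Unnormalised as ℚᵘ
open import Data.Rational.Unnormalised using (mkℚᵘ; *≡*)
open import Data.Rational.Unnormalised.Properties using (module ≃-Reasoning; ≃-sym)
open import Algebra.Properties.AbelianGroup +-0-abelianGroup using (xyx⁻¹≈y)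
import Data.Nat.Coprimality as Coprime
open import Data.List using (_∷_; [])
open import Data.Product using (_×_; _,_; proj₁; proj₂; ∃-syntax)
open import Data.Sum using (reduce)
open import Function using (_$_)
open import Relation.Nullary using (contradiction)
open import Relation.Binary.PropositionalEquality

toℚᵘ-ℕ→ℚ : ∀ n → toℚᵘ (ℕ→ℚ n) ≡ mkℚᵘ (ℤ.+ n) 0
toℚᵘ-ℕ→ℚ n = cong toℚᵘ (normalize-coprime (Coprime.sym (Coprime.1-coprimeTo n)))

ℕ→ℚ-+ : ∀ m n → ℕ→ℚ (m + n) ≡ ℕ→ℚ m Q.+ ℕ→ℚ n
ℕ→ℚ-+ m n = toℚᵘ-injective (begin
  toℚᵘ (ℕ→ℚ (m + n))                      ≡⟨ toℚᵘ-ℕ→ℚ (m + n) ⟩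
  mkℚᵘ (ℤ.+ (m + n)) 0                    ≈⟨ *≡* (cong (ℤ._* ℤ.1ℤ) pos-+) ⟩
  mkℚᵘ (ℤ.+ m) 0 ℚᵘ.+ mkℚᵘ (ℤ.+ n) 0      ≡⟨ cong₂ ℚᵘ._+_ (toℚᵘ-ℕ→ℚ m) (toℚᵘ-ℕ→ℚ n) ⟨
  toℚᵘ (ℕ→ℚ m) ℚᵘ.+ toℚᵘ (ℕ→ℚ n)          ≈⟨ ≃-sym (toℚᵘ-homo-+ (ℕ→ℚ m) (ℕ→ℚ n)) ⟩
  toℚᵘ (ℕ→ℚ m Q.+ ℕ→ℚ n)                  ∎)
  where
  open ≃-Reasoning
  pos-+ : (ℤ.+ (m + n)) ≡ (ℤ.+ m) ℤ.* ℤ.1ℤ ℤ.+ (ℤ.+ n) ℤ.* ℤ.1ℤ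
  pos-+ = trans (ℤ.pos-+ m n) (sym (cong₂ ℤ._+_ (ℤ.*-identityʳ (ℤ.+ m)) (ℤ.*-identityʳ (ℤ.+ n))))

ℕ→ℚ-* : ∀ m n → ℕ→ℚ (m * n) ≡ ℕ→ℚ m Q.* ℕ→ℚ n
ℕ→ℚ-* m n = toℚᵘ-injective (begin
  toℚᵘ (ℕ→ℚ (m * n))                      ≡⟨ toℚᵘ-ℕ→ℚ (m * n) ⟩
  mkℚᵘ (ℤ.+ (m * n)) 0                    ≈⟨ *≡* (cong (ℤ._* ℤ.1ℤ) (ℤ.pos-* m n)) ⟩
  mkℚᵘ (ℤ.+ m) 0 ℚᵘ.* mkℚᵘ (ℤ.+ n) 0      ≡⟨ cong₂ ℚᵘ._*_ (toℚᵘ-ℕ→ℚ m) (toℚᵘ-ℕ→ℚ n) ⟨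
  toℚᵘ (ℕ→ℚ m) ℚᵘ.* toℚᵘ (ℕ→ℚ n)          ≈⟨ ≃-sym (toℚᵘ-homo-* (ℕ→ℚ m) (ℕ→ℚ n)) ⟩
  toℚᵘ (ℕ→ℚ m Q.* ℕ→ℚ n)                  ∎)
  where open ≃-Reasoning

ℕ→ℚ[m+n]-ℕ→ℚ[m] : ∀ m n → ℕ→ℚ (m + n) Q.- ℕ→ℚ m ≡ ℕ→ℚ n
ℕ→ℚ[m+n]-ℕ→ℚ[m] m n = trans (cong (Q._- ℕ→ℚ m) (ℕ→ℚ-+ m n)) (xyx⁻¹≈y (ℕ→ℚ m) (ℕ→ℚ n))

ℕ→ℚ-*-cancelˡ : ∀ {n y z} → 1 ≤ n → ℕ→ℚ n Q.* y ≡ ℕ→ℚ n Q.* z → y ≡ z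
ℕ→ℚ-*-cancelˡ {suc k} {y} {z} _ eq = begin
  y                    ≡⟨ ℚ-*-identityˡ y ⟨
  1ℚ Q.* y             ≡⟨ cong (Q._* y) (*-inverseˡ n) ⟨
  1/ n Q.* n Q.* y     ≡⟨ ℚ-*-assoc (1/ n) n y ⟩
  1/ n Q.* (n Q.* y)   ≡⟨ cong (1/ n Q.*_) eq ⟩
  1/ n Q.* (n Q.* z)   ≡⟨ ℚ-*-assoc (1/ n) n z ⟨
  1/ n Q.* n Q.* z     ≡⟨ cong (Q._* z) (*-inverseˡ n) ⟩
  1ℚ Q.* z             ≡⟨ ℚ-*-identityˡ z ⟩
  z                    ∎
  where
  open ≡-Reasoning
  n = ℕ→ℚ (suc k)
  instance
    _ = pos⇒nonZero n {{normalize-pos (suc k) 1}}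

exchange-determines : ∀ {A B C D y} → 1 ≤ A → A * D ≡ B * C + 1 →
  ℕ→ℚ A Q.* y ≡ ℕ→ℚ B Q.* ℕ→ℚ C Q.+ 1ℚ → y ≡ ℕ→ℚ D
exchange-determines {A} {B} {C} {D} {y} 1≤A AD≡BC+1 eq = ℕ→ℚ-*-cancelˡ 1≤A (begin
  ℕ→ℚ A Q.* y                   ≡⟨ eq ⟩
  ℕ→ℚ B Q.* ℕ→ℚ C Q.+ 1ℚ        ≡⟨ cong (Q._+ 1ℚ) (ℕ→ℚ-* B C) ⟨
  ℕ→ℚ (B * C) Q.+ 1ℚ            ≡⟨ ℕ→ℚ-+ (B * C) 1 ⟨
  ℕ→ℚ (B * C + 1)               ≡⟨ cong ℕ→ℚ AD≡BC+1 ⟨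
  ℕ→ℚ (A * D)                   ≡⟨ ℕ→ℚ-* A D ⟩
  ℕ→ℚ A Q.* ℕ→ℚ D               ∎)
  where open ≡-Reasoning

-- The norm-one equation and the orbit of (1, 0)

record NormOne (c e b : ℕ) : Set where
  constructor normOne
  field equation : e * e + c * b * e ≡ 1 + c * b * b

mutual
  blockStart : ℕ → ℕ → ℕ
  blockStart c zero    = 1
  blockStart c (suc k) = blockStart c k + c * blockSlope c k

  blockSlope : ℕ → ℕ → ℕ
  blockSlope c zero    = 0
  blockSlope c (suc k) = blockSlope c k + blockStart c (suc k)

blockValue : ℕ → ℕ → ℕ → ℕ
blockValue c k j = j * blockSlope c k + blockStart c k

-- The step changes both sides of NormOne by the same amount.
normOne-step-balance : ∀ c e b → let e′ = e + c * b ; b′ = b + e′ in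
  (e′ * e′ + c * b′ * e′) + (1 + c * b * b) ≡ (1 + c * b′ * b′) + (e * e + c * b * e)
normOne-step-balance = solve-∀

normOne-step : ∀ {c e b} → NormOne c e b → NormOne c (e + c * b) (b + (e + c * b))
normOne-step {c} {e} {b} (normOne n) = normOne $ +-cancelʳ-≡ (1 + c * b * b) _ _
  (trans (normOne-step-balance c e b) (cong (1 + c * b′ * b′ +_) n))
  where b′ = b + (e + c * b)

normOne-unstep : ∀ {c e b} → NormOne c (e + c * b) (b + (e + c * b)) → NormOne c e b
normOne-unstep {c} {e} {b} (normOne n) = normOne $ sym $ +-cancelˡ-≡ _ _ _
  (trans (cong (_+ (1 + c * b * b)) (sym n)) (normOne-step-balance c e b))

normOne-origin : ∀ c → NormOne c 1 0
normOne-origin c = normOne (solve (c ∷ []))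

normOne-orbit : ∀ c k → NormOne c (blockStart c k) (blockSlope c k)
normOne-orbit c zero    = normOne-origin c
normOne-orbit c (suc k) = normOne-step {c} {blockStart c k} (normOne-orbit c k)

normOne⇒1≤start : ∀ {c e b} → NormOne c e b → 1 ≤ e
normOne⇒1≤start {c} {zero}  {b} (normOne n) = contradiction (trans (sym (*-zeroʳ (c * b))) n) 0≢1+n
normOne⇒1≤start {e = suc _}     _ = s≤s z≤n

1≤blockStart : ∀ c k → 1 ≤ blockStart c k
1≤blockStart c k = normOne⇒1≤start (normOne-orbit c k)

1≤blockSlope-suc : ∀ c k → 1 ≤ blockSlope c (suc k)
1≤blockSlope-suc c k = ≤-trans (1≤blockStart c (suc k)) (m≤n+m _ (blockSlope c k))

normOne-zeroSlope : ∀ {c e} → NormOne c e 0 → e ≡ 1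
normOne-zeroSlope {c} {e} (normOne n) = m*n≡1⇒n≡1 e e (begin
  e * e                 ≡⟨ solve (c ∷ e ∷ []) ⟩
  e * e + c * 0 * e     ≡⟨ n ⟩
  1 + c * 0 * 0         ≡⟨ solve (c ∷ []) ⟩
  1                     ∎)
  where open ≡-Reasoning

normOne⇒start≤slope : ∀ {c e b} → NormOne c e b → 1 ≤ b → e ≤ b
normOne⇒start≤slope {c} {e} {b} (normOne n) 1≤b = ≮⇒≥ λ b<e →
  let 1<e = <-≤-trans (s≤s 1≤b) b<e in
  <-irrefl (sym n) (+-mono-<-≤ (*-mono-< 1<e 1<e) (*-monoʳ-≤ (c * b) (<⇒≤ b<e)))

-- Written out, NormOne c e (d + e) says e² = 1 + c·d·e + c·d², which forbids e < c·d.
normOne⇒slopeGap : ∀ {c d e} → NormOne c e (d + e) → c * d ≤ e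
normOne⇒slopeGap {c} {d} {e} (normOne n) = ≮⇒≥ λ e<cd → <-irrefl n (begin-strict
  e * e + c * (d + e) * e           ≡⟨ solve (c ∷ d ∷ e ∷ []) ⟩
  e * e + (c * d * e + c * e * e)   ≤⟨ +-monoˡ-≤ _ (*-monoˡ-≤ e (<⇒≤ e<cd)) ⟩
  c * d * e + (c * d * e + c * e * e)
    <⟨ s≤s (m≤n+m _ (c * d * d)) ⟩
  1 + c * d * d + (c * d * e + (c * d * e + c * e * e))
    ≡⟨ solve (c ∷ d ∷ e ∷ []) ⟩
  1 + c * (d + e) * (d + e)         ∎)
  where open ≤-Reasoning

normOne-predecessor : ∀ {c E B} → NormOne c E B → 1 ≤ B →
  ∃[ e ] ∃[ b ] (b < B × e + c * b ≡ E × b + E ≡ B × NormOne c e b)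
normOne-predecessor {c} {E} {B} n 1≤B =
  e , b , subst (b <_) b+E≡B (m<m+n b (normOne⇒1≤start n)) , e+cb≡E , b+E≡B ,
  normOne-unstep (subst (λ E′ → NormOne c E′ (b + E′)) (sym e+cb≡E) n′)
  where
  b = B ∸ E
  b+E≡B : b + E ≡ B
  b+E≡B = m∸n+n≡m (normOne⇒start≤slope n 1≤B)
  n′ : NormOne c E (b + E)
  n′ = subst (NormOne c E) (sym b+E≡B) n
  e = E ∸ c * b
  e+cb≡E : e + c * b ≡ E
  e+cb≡E = m∸n+n≡m (normOne⇒slopeGap n′)

normOne⇒onOrbit : ∀ {c e b} → NormOne c e b → ∃[ k ] (blockStart c k ≡ e × blockSlope c k ≡ b)
normOne⇒onOrbit {c} {e} {b} = <-rec OnOrbit descend b e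
  where
  OnOrbit : ℕ → Set
  OnOrbit b = ∀ e → NormOne c e b → ∃[ k ] (blockStart c k ≡ e × blockSlope c k ≡ b)
  descend : ∀ B → (∀ {b} → b < B → OnOrbit b) → OnOrbit B
  descend zero    _  E n = 0 , sym (normOne-zeroSlope n) , refl
  descend (suc B) ih E n with normOne-predecessor n (s≤s z≤n)
  ... | e , b , b<B , e+cb≡E , b+E≡B , n′ with ih b<B e n′
  ... | k , start≡e , slope≡b = suc k , start≡E , slope≡B
    where
    start≡E : blockStart c (suc k) ≡ E
    start≡E = trans (cong₂ (λ s t → s + c * t) start≡e slope≡b) e+cb≡E
    slope≡B : blockSlope c (suc k) ≡ suc B
    slope≡B = trans (cong₂ _+_ slope≡b start≡E) b+E≡B

normOne⇒step-exchange : ∀ {c e b} → NormOne c e b → e * (b + (e + c * b)) ≡ b * (e + c * b) + 1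
normOne⇒step-exchange {c} {e} {b} (normOne n) = begin
  e * (b + (e + c * b))           ≡⟨ solve (c ∷ e ∷ b ∷ []) ⟩
  (e * e + c * b * e) + e * b     ≡⟨ cong (_+ e * b) n ⟩
  (1 + c * b * b) + e * b         ≡⟨ solve (c ∷ e ∷ b ∷ []) ⟩
  b * (e + c * b) + 1             ∎
  where open ≡-Reasoning

progression-exchange : ∀ {e b e′ b′} → e * b′ ≡ b * e′ + 1 → ∀ j →
  (j * b + e) * (suc j * b′ + e′) ≡ (suc j * b + e) * (j * b′ + e′) + 1
progression-exchange {e} {b} {e′} {b′} eb′≡be′+1 j = begin
  (j * b + e) * (suc j * b′ + e′)
    ≡⟨ solve (j ∷ b ∷ e ∷ b′ ∷ e′ ∷ []) ⟩
  j * suc j * b * b′ + j * b * e′ + j * e * b′ + e * e′ + e * b′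
    ≡⟨ cong (j * suc j * b * b′ + j * b * e′ + j * e * b′ + e * e′ +_) eb′≡be′+1 ⟩
  j * suc j * b * b′ + j * b * e′ + j * e * b′ + e * e′ + (b * e′ + 1)
    ≡⟨ solve (j ∷ b ∷ e ∷ b′ ∷ e′ ∷ []) ⟩
  (suc j * b + e) * (j * b′ + e′) + 1
    ∎
  where open ≡-Reasoning

blockValue-exchange : ∀ c k j →
  blockValue c k j * blockValue c (suc k) (suc j) ≡ blockValue c k (suc j) * blockValue c (suc k) j + 1
blockValue-exchange c k = progression-exchange (normOne⇒step-exchange (normOne-orbit c k))

blockValue-last : ∀ c k → blockValue c k c ≡ blockValue c (suc k) 0
blockValue-last c k = +-comm (c * blockSlope c k) (blockStart c k)

blockValue-suc : ∀ c k j → blockValue c k (suc j) ≡ blockValue c k j + blockSlope c k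
blockValue-suc c k j = progression-suc j (blockSlope c k) (blockStart c k)
  where
  progression-suc : ∀ j b e → suc j * b + e ≡ j * b + e + b
  progression-suc = solve-∀

-- The sequence is the blockwise arithmetic progression

-- The index N + 1 − t of the paper, read inside block m.
reflect-index : ∀ {c} m {i j} → i + j ≡ c → c * m + suc c + 1 ∸ suc i ≡ c * m + suc j
reflect-index m {i} {j} refl = trans (cong (_∸ suc i) split) (m+n∸m≡n (suc i) ((i + j) * m + suc j))
  where
  split : (i + j) * m + suc (i + j) + 1 ≡ suc i + ((i + j) * m + suc j)
  split = solve (m ∷ i ∷ j ∷ [])

module _ {c : ℕ} {x : ℕ → ℚ} (x-P1 : IsP1Sequence (suc c) x) where

  BlockAgrees : ℕ → Set
  BlockAgrees k = ∀ j → j ≤ c → x (c * k + suc j) ≡ ℕ→ℚ (blockValue c k j)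

  firstBlock : BlockAgrees 0
  firstBlock j j≤c = begin
    x (c * 0 + suc j)          ≡⟨ cong (λ i → x (i + suc j)) (*-zeroʳ c) ⟩
    x (suc j)                  ≡⟨ proj₁ x-P1 (suc j) (s≤s z≤n) (s≤s j≤c) ⟩
    1ℚ                         ≡⟨ cong (λ i → ℕ→ℚ (i + 1)) (*-zeroʳ j) ⟨
    ℕ→ℚ (blockValue c 0 j)     ∎
    where open ≡-Reasoning

  nextBlock : ∀ {k} → BlockAgrees k → BlockAgrees (suc k)
  nextBlock {k} prev zero _ = begin
    x (c * suc k + 1)            ≡⟨ cong x (solve (c ∷ k ∷ [])) ⟩
    x (c * k + suc c)            ≡⟨ prev c ≤-refl ⟩
    ℕ→ℚ (blockValue c k c)       ≡⟨ cong ℕ→ℚ (blockValue-last c k) ⟩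
    ℕ→ℚ (blockValue c (suc k) 0) ∎
    where open ≡-Reasoning
  nextBlock {k} prev (suc j) 1+j≤c =
    exchange-determines {blockValue c k j} {blockValue c k (suc j)} {blockValue c (suc k) j}
      (≤-trans (1≤blockStart c k) (m≤n+m _ _)) (blockValue-exchange c k j) (begin
      ℕ→ℚ (blockValue c k j) Q.* x (c * suc k + suc (suc j))
        ≡⟨ cong₂ Q._*_ (prev j j≤c) (cong x n+1+c≡) ⟨
      x n Q.* x (n + suc c)
        ≡⟨ proj₂ x-P1 n (≤-trans (s≤s z≤n) (m≤n+m (suc j) (c * k))) ⟩
      x (suc n) Q.* x (n + suc c ∸ 1) Q.+ 1ℚ
        ≡⟨ cong₂ (λ u v → u Q.* v Q.+ 1ℚ) x[n+1] x[n+c] ⟩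
      ℕ→ℚ (blockValue c k (suc j)) Q.* ℕ→ℚ (blockValue c (suc k) j) Q.+ 1ℚ
        ∎)
    where
    open ≡-Reasoning
    n = c * k + suc j
    j≤c : j ≤ c
    j≤c = ≤-trans (n≤1+n j) 1+j≤c
    x[n+1] : x (suc n) ≡ ℕ→ℚ (blockValue c k (suc j))
    x[n+1] = trans (cong x (sym (+-suc (c * k) (suc j)))) (prev (suc j) 1+j≤c)
    n+1+c≡ : c * k + suc j + suc c ≡ c * suc k + suc (suc j)
    n+1+c≡ = solve (c ∷ k ∷ j ∷ [])
    n+c≡ : c * k + suc j + c ≡ c * suc k + suc j
    n+c≡ = solve (c ∷ k ∷ j ∷ [])
    x[n+c] : x (n + suc c ∸ 1) ≡ ℕ→ℚ (blockValue c (suc k) j)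
    x[n+c] = trans (cong x (trans (cong (_∸ 1) (+-suc n c)) n+c≡)) (nextBlock prev j j≤c)

  P1-blockValue : ∀ k → BlockAgrees k
  P1-blockValue zero    = firstBlock
  P1-blockValue (suc k) = nextBlock (P1-blockValue k)

  P1-slope : ∀ m {t} → 1 ≤ t → t ≤ c → x (c * m + t + 1) Q.- x (c * m + t) ≡ ℕ→ℚ (blockSlope c m)
  P1-slope m {suc j} _ t≤c = begin
    x (c * m + suc j + 1) Q.- x (c * m + suc j)
      ≡⟨ cong₂ Q._-_ (trans (cong x index) (P1-blockValue m (suc j) t≤c))
                     (P1-blockValue m j (≤-trans (n≤1+n j) t≤c)) ⟩
    ℕ→ℚ (blockValue c m (suc j)) Q.- ℕ→ℚ (blockValue c m j)
      ≡⟨ cong (λ v → ℕ→ℚ v Q.- ℕ→ℚ (blockValue c m j)) (blockValue-suc c m j) ⟩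
    ℕ→ℚ (blockValue c m j + blockSlope c m) Q.- ℕ→ℚ (blockValue c m j)
      ≡⟨ ℕ→ℚ[m+n]-ℕ→ℚ[m] (blockValue c m j) (blockSlope c m) ⟩
    ℕ→ℚ (blockSlope c m)
      ∎
    where
    open ≡-Reasoning
    index : c * m + suc j + 1 ≡ c * m + suc (suc j)
    index = trans (+-assoc (c * m) (suc j) 1) (cong (c * m +_) (+-comm (suc j) 1))

  P1-reflectedSum : ∀ m {t} → 1 ≤ t → t ≤ suc c →
    x (c * m + t) Q.+ x (c * m + suc c + 1 ∸ t)
      ≡ ℕ→ℚ (c * blockSlope c m + (blockStart c m + blockStart c m))
  P1-reflectedSum m {suc i} _ t≤1+c with m≤n⇒∃[o]m+o≡n (s≤s⁻¹ t≤1+c)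
  ... | j , i+j≡c = begin
    x (c * m + suc i) Q.+ x (c * m + suc c + 1 ∸ suc i)
      ≡⟨ cong₂ Q._+_ (P1-blockValue m i (s≤s⁻¹ t≤1+c))
                     (trans (cong x (reflect-index m i+j≡c)) (P1-blockValue m j j≤c)) ⟩
    ℕ→ℚ (blockValue c m i) Q.+ ℕ→ℚ (blockValue c m j)
      ≡⟨ ℕ→ℚ-+ (blockValue c m i) (blockValue c m j) ⟨
    ℕ→ℚ (blockValue c m i + blockValue c m j)
      ≡⟨ cong ℕ→ℚ (trans (merge i j b e) (cong (λ n → n * b + (e + e)) i+j≡c)) ⟩
    ℕ→ℚ (c * b + (e + e))
      ∎
    where
    open ≡-Reasoning
    b = blockSlope c m
    e = blockStart c m
    j≤c : j ≤ c
    j≤c = subst (j ≤_) i+j≡c (m≤n+m j i)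
    merge : ∀ i j b e → i * b + e + (j * b + e) ≡ (i + j) * b + (e + e)
    merge = solve-∀

-- Completing the square

Pell : ℕ → ℕ → ℕ → ℕ → Set
Pell n D p q = p ^ 2 ≡ n + D * q ^ 2

square : ∀ n → n ^ 2 ≡ n * n
square n = cong (n *_) (*-identityʳ n)

completeSquare : ∀ {A p Z} → p * p ≡ A * A + Z → ∃[ e ] (A + e ≡ p × e * e + 2 * A * e ≡ Z)
completeSquare {A} {p} {Z} eq with m≤n⇒∃[o]m+o≡n A≤p
  where
  A≤p : A ≤ p
  A≤p = ≮⇒≥ λ p<A → <-irrefl eq (<-≤-trans (*-mono-< p<A p<A) (m≤m+n (A * A) Z))
... | e , refl = e , refl , +-cancelˡ-≡ (A * A) _ _ (begin
  A * A + (e * e + 2 * A * e)   ≡⟨ solve (A ∷ e ∷ []) ⟩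
  (A + e) * (A + e)             ≡⟨ eq ⟩
  A * A + Z                     ∎)
  where open ≡-Reasoning

2∣n*n⇒2∣n : ∀ {n} → 2 ∣ n * n → 2 ∣ n
2∣n*n⇒2∣n {n} 2∣n*n = reduce (euclidsLemma n n prime[2] 2∣n*n)

[1+s]^2∸1 : ∀ s → suc s ^ 2 ∸ 1 ≡ s * s + (s + s)
[1+s]^2∸1 s = cong (_∸ 1) (trans (square (suc s)) expand)
  where
  expand : suc s * suc s ≡ 1 + (s * s + (s + s))
  expand = solve (s ∷ [])

[c+2]^2∸4 : ∀ c → (c + 2) ^ 2 ∸ 4 ≡ c * c + 4 * c
[c+2]^2∸4 c = trans (cong (_∸ 4) (trans (square (c + 2)) expand)) (m+n∸n≡m (c * c + 4 * c) 4)
  where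
  expand : (c + 2) * (c + 2) ≡ c * c + 4 * c + 4
  expand = solve (c ∷ [])

pell-odd-rhs : ∀ s q → 1 + (suc s ^ 2 ∸ 1) * q ^ 2 ≡ s * q * (s * q) + (1 + (s + s) * q * q)
pell-odd-rhs s q = begin
  1 + (suc s ^ 2 ∸ 1) * q ^ 2            ≡⟨ cong₂ (λ D r → 1 + D * r) ([1+s]^2∸1 s) (square q) ⟩
  1 + (s * s + (s + s)) * (q * q)        ≡⟨ solve (s ∷ q ∷ []) ⟩
  s * q * (s * q) + (1 + (s + s) * q * q) ∎
  where open ≡-Reasoning

pell-even-rhs : ∀ c q → 4 + ((c + 2) ^ 2 ∸ 4) * q ^ 2 ≡ c * q * (c * q) + 4 * (1 + c * q * q)
pell-even-rhs c q = begin
  4 + ((c + 2) ^ 2 ∸ 4) * q ^ 2           ≡⟨ cong₂ (λ D r → 4 + D * r) ([c+2]^2∸4 c) (square q) ⟩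
  4 + (c * c + 4 * c) * (q * q)           ≡⟨ solve (c ∷ q ∷ []) ⟩
  c * q * (c * q) + 4 * (1 + c * q * q)   ∎
  where open ≡-Reasoning

pell-odd-forward : ∀ {c s e q} → c ≡ s + s → NormOne c e q → Pell 1 (suc s ^ 2 ∸ 1) (s * q + e) q
pell-odd-forward {s = s} {e} {q} refl (normOne n) = begin
  (s * q + e) ^ 2                                  ≡⟨ square (s * q + e) ⟩
  (s * q + e) * (s * q + e)                        ≡⟨ solve (s ∷ q ∷ e ∷ []) ⟩
  s * q * (s * q) + (e * e + (s + s) * q * e)      ≡⟨ cong (s * q * (s * q) +_) n ⟩
  s * q * (s * q) + (1 + (s + s) * q * q)          ≡⟨ pell-odd-rhs s q ⟨
  1 + (suc s ^ 2 ∸ 1) * q ^ 2                      ∎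
  where open ≡-Reasoning

pell-odd-backward : ∀ {c s p q} → c ≡ s + s → Pell 1 (suc s ^ 2 ∸ 1) p q →
  ∃[ e ] (s * q + e ≡ p × NormOne c e q)
pell-odd-backward {s = s} {p} {q} refl pell
  with completeSquare (trans (sym (square p)) (trans pell (pell-odd-rhs s q)))
... | e , sq+e≡p , offset = e , sq+e≡p , normOne (trans (regroup s q e) offset)
  where
  regroup : ∀ s q e → e * e + (s + s) * q * e ≡ e * e + 2 * (s * q) * e
  regroup = solve-∀

pell-even-forward : ∀ {c d e q} → d ≡ c + 2 → NormOne c e q → Pell 4 (d ^ 2 ∸ 4) (c * q + (e + e)) q
pell-even-forward {c} {e = e} {q} refl (normOne n) = begin
  (c * q + (e + e)) ^ 2                            ≡⟨ square (c * q + (e + e)) ⟩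
  (c * q + (e + e)) * (c * q + (e + e))            ≡⟨ solve (c ∷ q ∷ e ∷ []) ⟩
  c * q * (c * q) + 4 * (e * e + c * q * e)        ≡⟨ cong (λ r → c * q * (c * q) + 4 * r) n ⟩
  c * q * (c * q) + 4 * (1 + c * q * q)            ≡⟨ pell-even-rhs c q ⟨
  4 + ((c + 2) ^ 2 ∸ 4) * q ^ 2                    ∎
  where open ≡-Reasoning

-- Writing p = c·q + f, the equation f² + 2·c·q·f = 4·(1 + c·q²) forces f to be even.
pell-even-backward : ∀ {c d p q} → d ≡ c + 2 → Pell 4 (d ^ 2 ∸ 4) p q →
  ∃[ e ] (c * q + (e + e) ≡ p × NormOne c e q)
pell-even-backward {c} {p = p} {q} refl pell
  with completeSquare (trans (sym (square p)) (trans pell (pell-even-rhs c q)))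
... | f , cq+f≡p , offset with 2∣n*n⇒2∣n {f} (∣m+n∣m⇒∣n 2∣sum (∣-trans (m∣m*n (c * q)) (m∣m*n f)))
  where
  2∣sum : 2 ∣ 2 * (c * q) * f + f * f
  2∣sum = subst (2 ∣_) (trans (sym offset) (+-comm (f * f) (2 * (c * q) * f)))
                (∣-trans (divides 2 refl) (m∣m*n (1 + c * q * q)))
... | divides e refl = e , trans (cong (c * q +_) (m+m≡m*2 e)) cq+f≡p ,
  normOne (*-cancelˡ-≡ _ _ 4 (begin
    4 * (e * e + c * q * e)                     ≡⟨ solve (c ∷ q ∷ e ∷ []) ⟩
    e * 2 * (e * 2) + 2 * (c * q) * (e * 2)     ≡⟨ offset ⟩
    4 * (1 + c * q * q)                         ∎))
  where
  open ≡-Reasoning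
  m+m≡m*2 : ∀ e → e + e ≡ e * 2
  m+m≡m*2 = solve-∀

EnumeratesPositiveSolutions : (ℕ → ℚ) → (ℕ → ℚ) → (ℕ → ℕ → Set) → Set
EnumeratesPositiveSolutions a b R =
  (∀ (m : ℕ) → 1 ≤ m → ∃[ p ] ∃[ q ] (1 ≤ p × 1 ≤ q × a m ≡ ℕ→ℚ p × b m ≡ ℕ→ℚ q × R p q)) ×
  (∀ (p q : ℕ) → 1 ≤ p → 1 ≤ q → R p q → ∃[ m ] (1 ≤ m × a m ≡ ℕ→ℚ p × b m ≡ ℕ→ℚ q))

orbit-enumerates : ∀ {c} {a b : ℕ → ℚ} (R : ℕ → ℕ → Set) (f : ℕ → ℕ → ℕ) →
  (∀ e q → e ≤ f e q) →
  (∀ {e q} → NormOne c e q → R (f e q) q) →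
  (∀ {p q} → R p q → ∃[ e ] (f e q ≡ p × NormOne c e q)) →
  (∀ m → a m ≡ ℕ→ℚ (f (blockStart c m) (blockSlope c m))) →
  (∀ m → b m ≡ ℕ→ℚ (blockSlope c m)) →
  EnumeratesPositiveSolutions a b R
orbit-enumerates {c} {a} {b} R f e≤f forward backward a≡ b≡ = enumerate , locate
  where
  enumerate : ∀ m → 1 ≤ m → ∃[ p ] ∃[ q ] (1 ≤ p × 1 ≤ q × a m ≡ ℕ→ℚ p × b m ≡ ℕ→ℚ q × R p q)
  enumerate m@(suc k) _ =
    f (blockStart c m) (blockSlope c m) , blockSlope c m ,
    ≤-trans (1≤blockStart c m) (e≤f _ _) , 1≤blockSlope-suc c k , a≡ m , b≡ m ,
    forward (normOne-orbit c m)
  locate : ∀ p q → 1 ≤ p → 1 ≤ q → R p q → ∃[ m ] (1 ≤ m × a m ≡ ℕ→ℚ p × b m ≡ ℕ→ℚ q)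
  locate p q _ 1≤q Rpq with backward Rpq
  ... | e , refl , n with normOne⇒onOrbit n
  ... | zero  , _    , refl = contradiction 1≤q λ ()
  ... | suc k , refl , refl = suc k , s≤s z≤n , a≡ (suc k) , b≡ (suc k)

oddCase : ∀ {c s x} → IsP1Sequence (suc c) x → c ≡ s + s → ∀ {t} → 1 ≤ t → t ≤ c →
  EnumeratesPositiveSolutions (λ m → x (c * m + suc s)) (λ m → x (c * m + t + 1) Q.- x (c * m + t))
                              (Pell 1 (suc s ^ 2 ∸ 1))
oddCase {c} {s} x-P1 c≡s+s 1≤t t≤c =
  orbit-enumerates (Pell 1 (suc s ^ 2 ∸ 1)) (λ e q → s * q + e) (λ e q → m≤n+m e (s * q))
    (pell-odd-forward {s = s} c≡s+s) (pell-odd-backward {s = s} c≡s+s)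
    (λ m → P1-blockValue x-P1 m s (subst (s ≤_) (sym c≡s+s) (m≤m+n s s)))
    (λ m → P1-slope x-P1 m 1≤t t≤c)

evenCase : ∀ {c d x} → IsP1Sequence (suc c) x → d ≡ c + 2 →
  ∀ {t t′} → 1 ≤ t → t ≤ suc c → 1 ≤ t′ → t′ ≤ c →
  EnumeratesPositiveSolutions (λ m → x (c * m + t) Q.+ x (c * m + suc c + 1 ∸ t))
                              (λ m → x (c * m + t′ + 1) Q.- x (c * m + t′))
                              (Pell 4 (d ^ 2 ∸ 4))
evenCase {c} {d} x-P1 d≡c+2 1≤t t≤1+c 1≤t′ t′≤c =
  orbit-enumerates (Pell 4 (d ^ 2 ∸ 4)) (λ e q → c * q + (e + e))
    (λ e q → ≤-trans (m≤m+n e e) (m≤n+m (e + e) (c * q)))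
    (pell-even-forward d≡c+2) (pell-even-backward d≡c+2)
    (λ m → P1-reflectedSum x-P1 m 1≤t t≤1+c)
    (λ m → P1-slope x-P1 m 1≤t′ t′≤c)

2[1+s]∸1∸1≡s+s : ∀ s → 2 * suc s ∸ 1 ∸ 1 ≡ s + s
2[1+s]∸1∸1≡s+s s = trans (cong (_∸ 1) (+-suc s (s + 0))) (cong (s +_) (+-identityʳ s))

mainTheorem16 :
  -- (a) N = 2r - 1 odd (N ≥ 2, so r ≥ 2)
  (∀ (r : ℕ) → 2 ≤ r → (x : ℕ → ℚ) → IsP1Sequence (2 * r ∸ 1) x →
    ∀ (t : ℕ) → 1 ≤ t → t ≤ 2 * r ∸ 1 ∸ 1 →
      let N = 2 * r ∸ 1
          a = λ (m : ℕ) → x ((N ∸ 1) * m + r)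
          b = λ (m : ℕ) → x ((N ∸ 1) * m + t + 1) Q.- x ((N ∸ 1) * m + t)
      in (∀ (m : ℕ) → 1 ≤ m →
            ∃[ p ] ∃[ q ] (1 ≤ p × 1 ≤ q × a m ≡ ℕ→ℚ p × b m ≡ ℕ→ℚ q ×
              p ^ 2 ≡ 1 + (r ^ 2 ∸ 1) * q ^ 2))
         × (∀ (p q : ℕ) → 1 ≤ p → 1 ≤ q → p ^ 2 ≡ 1 + (r ^ 2 ∸ 1) * q ^ 2 →
            ∃[ m ] (1 ≤ m × a m ≡ ℕ→ℚ p × b m ≡ ℕ→ℚ q)))
  ×
  -- (b) N = 2r even (N ≥ 2, so r ≥ 1)
  (∀ (r : ℕ) → 1 ≤ r → (x : ℕ → ℚ) → IsP1Sequence (2 * r) x →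
    ∀ (t t' : ℕ) → 1 ≤ t → t ≤ r → 1 ≤ t' → t' ≤ 2 * r ∸ 1 →
      let N = 2 * r
          a = λ (m : ℕ) → x ((N ∸ 1) * m + t) Q.+ x ((N ∸ 1) * m + N + 1 ∸ t)
          b = λ (m : ℕ) → x ((N ∸ 1) * m + t' + 1) Q.- x ((N ∸ 1) * m + t')
      in (∀ (m : ℕ) → 1 ≤ m →
            ∃[ p ] ∃[ q ] (1 ≤ p × 1 ≤ q × a m ≡ ℕ→ℚ p × b m ≡ ℕ→ℚ q ×
              p ^ 2 ≡ 4 + ((2 * r + 1) ^ 2 ∸ 4) * q ^ 2))
         × (∀ (p q : ℕ) → 1 ≤ p → 1 ≤ q → p ^ 2 ≡ 4 + ((2 * r + 1) ^ 2 ∸ 4) * q ^ 2 →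
            ∃[ m ] (1 ≤ m × a m ≡ ℕ→ℚ p × b m ≡ ℕ→ℚ q)))
-- Matching r as a successor makes N reduce to suc c with c the term N ∸ 1 of the statement.
mainTheorem16 =
  (λ { zero ()
     ; (suc zero) (s≤s ())
     ; (suc (suc u)) _ x x-P1 t 1≤t t≤c →
         oddCase x-P1 (2[1+s]∸1∸1≡s+s (suc u)) 1≤t t≤c }) ,
  (λ { zero ()
     ; (suc u) _ x x-P1 t t′ 1≤t t≤r 1≤t′ t′≤c →
         evenCase x-P1 (sym (+-suc (2 * suc u ∸ 1) 1))
           1≤t (≤-trans t≤r (m≤m+n (suc u) (suc u + 0))) 1≤t′ t′≤c })
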